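{- Let $T$ be a tree and $x,y$ leaves of $T$. Let $P$ be the $xy$-path in $T$ and let $y'$ be the vertex adjacent to $y$. Label $V(P)=\{0,1,\ldots,r\}$ along the path with $x=0$ and $y=r$. For $i\in\{1,\ldots,r-1\}$ let $T_i$ be the union of the components of $T-V(P)$ that are adjacent to vertex $i$ in $T$ (the empty graph if there are none). If $T'$ is the tree obtained from $T$ by deleting $x$ and adding a new leaf adjacent to $y'$, then $$W(T')-W(T)=\sum_{i=1}^{r-1}(r-2i)|V(T_i)|-(r-2).$$
   Context: The Wiener index of a connected graph $G$ is $W(G)=\sum_{\{u,v\}\subseteq V(G)} d(u,v)$. A leaf is a vertex of degree one. -}

module Defs where

open import Data.Bool using (Bool; true; false; if_then_else_; _∧_; _∨_; not)
open import Data.Nat using (ℕ; zero; suc; _+_; _*_; _<ᵇ_; _≤ᵇ_; _≤_)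
open import Data.Fin using (Fin; zero; suc; toℕ; fromℕ; inject₁; _≟_)
open import Data.List using (List; allFin; map; foldr)
open import Data.Nat.ListAction using (sum)
open import Data.Bool.ListAction using (any)
open import Data.Integer as ℤ using (ℤ; +_)
open import Data.Product using (Σ; ∃; _×_)
open import Relation.Nullary using (¬_; ⌊_⌋)
open import Relation.Binary.PropositionalEquality using (_≡_)
open import Function.Definitions using (Injective)

Adj : ℕ → Set
Adj n = Fin n → Fin n → Bool

record SimpleGraph {n : ℕ} (A : Adj n) : Set where
  field
    symmetric : ∀ u v → A u v ≡ A v u
    loopless  : ∀ v → A v v ≡ false

data Walk {n : ℕ} (A : Adj n) : Fin n → Fin n → Set where
  [] : ∀ {v} → Walk A v v
  step : ∀ {u w v} → A u w ≡ true → Walk A w v → Walk A u v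

Connected : {n : ℕ} → Adj n → Set
Connected A = ∀ u v → Walk A u v

IsPath : {n : ℕ} → Adj n → (k : ℕ) → (Fin (suc k) → Fin n) → Set
IsPath A k p = Injective _≡_ _≡_ p × (∀ (i : Fin k) → A (p (inject₁ i)) (p (suc i)) ≡ true)

HasCycle : {n : ℕ} → Adj n → Set
HasCycle A = Σ ℕ λ k → Σ (Fin (suc k) → _) λ p →
  (2 ≤ k) × IsPath A k p × (A (p (fromℕ k)) (p zero) ≡ true)

record Tree {n : ℕ} (A : Adj n) : Set where
  field
    simple    : SimpleGraph A
    connected : Connected A
    acyclic   : ¬ HasCycle A

count : {n : ℕ} → (Fin n → Bool) → ℕ
count {n} f = sum (map (λ v → if f v then 1 else 0) (allFin n))

anyV : {n : ℕ} → (Fin n → Bool) → Bool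
anyV {n} f = any f (allFin n)

degree : {n : ℕ} → Adj n → Fin n → ℕ
degree A v = count (A v)

IsLeaf : {n : ℕ} → Adj n → Fin n → Set
IsLeaf A v = degree A v ≡ 1

reach : {n : ℕ} → Adj n → ℕ → Fin n → Fin n → Bool
reach A zero u v = ⌊ u ≟ v ⌋
reach A (suc k) u v = reach A k u v ∨ anyV (λ w → reach A k u w ∧ A w v)

-- least k ≤ m with f k = true (m if there is none)
least : (ℕ → Bool) → ℕ → ℕ
least f zero = 0
least f (suc m) = if f 0 then 0 else suc (least (λ k → f (suc k)) m)

-- distance: length of a shortest walk (in a connected graph on n vertices
-- the shortest walk has length < n, so the search bound n is never hit)
dist : {n : ℕ} → Adj n → Fin n → Fin n → ℕ
dist {n} A u v = least (λ k → reach A k u v) n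

wiener : {n : ℕ} → Adj n → ℕ
wiener {n} A = sum (map (λ u → sum (map (λ v → if toℕ u <ᵇ toℕ v then dist A u v else 0)
                                          (allFin n))) (allFin n))

-- T' : delete the leaf x and add a new leaf adjacent to y'.  The new leaf
-- reuses the vertex label x (so T' again has vertex set Fin n).
moveLeaf : {n : ℕ} → Adj n → Fin n → Fin n → Adj n
moveLeaf A x y' a b =
  if ⌊ a ≟ x ⌋ then ⌊ b ≟ y' ⌋
  else if ⌊ b ≟ x ⌋ then ⌊ a ≟ y' ⌋
  else A a b

onPath : {n r : ℕ} → (Fin (suc r) → Fin n) → Fin n → Bool
onPath {r = r} p v = any (λ j → ⌊ p j ≟ v ⌋) (allFin (suc r))

deletePath : {n r : ℕ} → Adj n → (Fin (suc r) → Fin n) → Adj n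
deletePath A p a b = A a b ∧ not (onPath p a) ∧ not (onPath p b)

inTi : {n r : ℕ} → Adj n → (Fin (suc r) → Fin n) → Fin (suc r) → Fin n → Bool
inTi {n} A p i v =
  not (onPath p v) ∧
  anyV (λ w → A w (p i) ∧ not (onPath p w) ∧ reach (deletePath A p) n v w)

sizeTi : {n r : ℕ} → Adj n → (Fin (suc r) → Fin n) → Fin (suc r) → ℕ
sizeTi A p i = count (inTi A p i)

sumInner : (r : ℕ) → (Fin (suc r) → ℤ) → ℤ
sumInner r f = foldr ℤ._+_ (+ 0)
  (map (λ i → if (1 ≤ᵇ toℕ i) ∧ (toℕ i <ᵇ r) then f i else + 0) (allFin (suc r)))

-- Distances between vertices other than x are the same in T and T′, so W(T′) − W(T) is the sum over v
-- of d′(x,v) − d(x,v). For v ≠ x both distances run through the unique neighbour of x (y′ = r − 1 in T′,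
-- 1 in T), so the summand is d(r − 1, v) − d(1, v). If v is the path vertex i or lies in T_i, then
-- d(j, v) = |j − i| + d(i, v) for every path vertex j, because the edges of the path between j and i
-- separate j from v in the tree. Hence the summand is r − 2i for v ∈ V(T_i) ∪ {i} with 0 < i < r,
-- 0 for v = x and 2 − r for v = y; since Σ_{i=1}^{r−1} (r − 2i) = 0 this sums to the formula.

module Submission where

open import Defs
open import Data.Nat using (ℕ; suc)
open import Data.Nat as ℕ using ()
open import Data.Fin using (Fin; zero; fromℕ; toℕ)
open import Data.Integer using (ℤ; +_; _-_; _*_)
open import Data.Bool using (true)
open import Relation.Binary.PropositionalEquality using (_≡_; _≢_)

open import Level using (0ℓ)
open import Function using (_∘_; id)
open import Function.Bundles using (Equivalence)
open import Function.Definitions using (Injective)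
open import Data.Empty using (⊥; ⊥-elim)
open import Data.Unit using (⊤; tt)
open import Data.Product using (Σ; ∃; _×_; _,_; proj₁; proj₂)
open import Data.Sum using (_⊎_; inj₁; inj₂)
open import Data.Bool using (Bool; false; _∧_; _∨_; not; if_then_else_; T)
open import Data.Bool.Properties using (T-≡)
open import Data.Nat using (zero; _+_; _≤_; _<_; z≤n; s≤s; _<?_; _<ᵇ_; _≤ᵇ_)
open import Data.Nat.Properties hiding (_≟_)
open import Data.Nat.ListAction using () renaming (sum to sumℕ)
open import Data.Fin using (suc; inject₁; _≟_; fromℕ<; punchIn)
open import Data.Fin.Properties
  using (punchInᵢ≢i; any?; injective⇒≤; toℕ-fromℕ<; toℕ-inject₁; toℕ-injective; toℕ≤pred[n]; toℕ-fromℕ)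
open import Data.Integer using (-_; -1ℤ) renaming (_+_ to _+ᶻ_)
open import Data.Integer.Properties as ℤ using (-1*i≡-i)
  renaming ( +-identityˡ to +ᶻ-identityˡ; +-identityʳ to +ᶻ-identityʳ; +-inverseʳ to +ᶻ-inverseʳ
           ; *-zeroʳ to *ᶻ-zeroʳ; *-identityʳ to *ᶻ-identityʳ)
open import Data.Integer.Tactic.RingSolver using (solve-∀)
open import Algebra.Properties.Semiring.Sum ℤ.+-*-semiring
  using (sum-syntax; sum-cong-≗; ∑-distrib-+; ∑-comm; *-distribˡ-sum; sum-remove; sum-replicate-zero; sum-init-last)
open import Data.List using (allFin; map; foldr; tabulate)
open import Data.List.Properties using (map-tabulate)
open import Data.List.Relation.Unary.Any using (satisfied)
open import Data.List.Relation.Unary.Any.Properties using (any⁺; any⁻)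
open import Data.List.Membership.Propositional using (lose)
open import Data.List.Membership.Propositional.Properties using (∈-allFin)
open import Relation.Nullary using (¬_; Dec; yes; no; ⌊_⌋; contradiction)
open import Relation.Nullary.Decidable using (toWitness; isYes≗does; dec-true; dec-false; _×-dec_; _⊎-dec_)
open import Relation.Binary.Core using (Rel)
open import Relation.Binary.Definitions using (tri<; tri≈; tri>)
open import Relation.Binary.PropositionalEquality
  using (refl; sym; trans; cong; cong₂; subst; subst₂; module ≡-Reasoning)
open import Relation.Binary.Construct.Closure.ReflexiveTransitive as Star
  using (Star; ε; _◅_; _◅◅_; revApp; reverse)

-- Walks

module Walks {n : ℕ} {R : Rel (Fin n) 0ℓ} where

  length : ∀ {u v} → Star R u v → ℕ
  length ε = 0
  length (_ ◅ ω) = suc (length ω)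

  vertex : ∀ {u v} (ω : Star R u v) → Fin (suc (length ω)) → Fin n
  vertex {u} _ zero = u
  vertex (_ ◅ ω) (suc i) = vertex ω i

  vertex-last : ∀ {u v} (ω : Star R u v) → vertex ω (fromℕ (length ω)) ≡ v
  vertex-last ε = refl
  vertex-last (_ ◅ ω) = vertex-last ω

  vertex-step : ∀ {u v} (ω : Star R u v) (i : Fin (length ω)) →
                R (vertex ω (inject₁ i)) (vertex ω (suc i))
  vertex-step (h ◅ _) zero = h
  vertex-step (_ ◅ ω) (suc i) = vertex-step ω i

  Simple : ∀ {u v} → Star R u v → Set
  Simple ε = ⊤
  Simple {u} (_ ◅ ω) = (∀ i → vertex ω i ≢ u) × Simple ω

  vertex-injective : ∀ {u v} (ω : Star R u v) → Simple ω → Injective _≡_ _≡_ (vertex ω)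
  vertex-injective ε _ {zero} {zero} _ = refl
  vertex-injective (_ ◅ ω) _ {zero} {zero} _ = refl
  vertex-injective (_ ◅ ω) (fresh , _) {zero} {suc j} e = ⊥-elim (fresh j (sym e))
  vertex-injective (_ ◅ ω) (fresh , _) {suc i} {zero} e = ⊥-elim (fresh i e)
  vertex-injective (_ ◅ ω) (_ , s) {suc i} {suc j} e = cong suc (vertex-injective ω s e)

  simple-length< : ∀ {u v} (ω : Star R u v) → Simple ω → length ω < n
  simple-length< ω s = injective⇒≤ (vertex-injective ω s)

  drop : ∀ {u v} (ω : Star R u v) (i : Fin (suc (length ω))) → Star R (vertex ω i) v
  drop ω zero = ω
  drop (_ ◅ ω) (suc i) = drop ω i

  length-drop : ∀ {u v} (ω : Star R u v) i → length (drop ω i) ≤ length ω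
  length-drop ω zero = ≤-refl
  length-drop (_ ◅ ω) (suc i) = m≤n⇒m≤1+n (length-drop ω i)

  drop-simple : ∀ {u v} (ω : Star R u v) i → Simple ω → Simple (drop ω i)
  drop-simple ω zero s = s
  drop-simple (_ ◅ ω) (suc i) (_ , s) = drop-simple ω i s

  shortcut : ∀ {u v} (ω : Star R u v) → Σ (Star R u v) λ ω′ → Simple ω′ × length ω′ ≤ length ω
  shortcut ε = ε , tt , z≤n
  shortcut {u} (h ◅ ω) with shortcut ω
  ... | ω₁ , s₁ , l₁ with any? (λ i → vertex ω₁ i ≟ u)
  ... | yes (i , refl) = drop ω₁ i , drop-simple ω₁ i s₁ , m≤n⇒m≤1+n (≤-trans (length-drop ω₁ i) l₁)
  ... | no ∄i = h ◅ ω₁ , ((λ i e → ∄i (i , e)) , s₁) , s≤s l₁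

  length-◅◅ : ∀ {u w v} (ω : Star R u w) (ω′ : Star R w v) → length (ω ◅◅ ω′) ≡ length ω + length ω′
  length-◅◅ ε ω′ = refl
  length-◅◅ (_ ◅ ω) ω′ = cong suc (length-◅◅ ω ω′)

  length-revApp : (flip : ∀ {a b} → R a b → R b a) → ∀ {u w v} (ω : Star R w u) (ω′ : Star R w v) →
                  length (revApp flip ω ω′) ≡ length ω + length ω′
  length-revApp flip ε ω′ = refl
  length-revApp flip (h ◅ ω) ω′ = trans (length-revApp flip ω (flip h ◅ ω′)) (+-suc (length ω) (length ω′))

  length-reverse : (flip : ∀ {a b} → R a b → R b a) → ∀ {u v} (ω : Star R u v) →
                   length (reverse flip ω) ≡ length ω
  length-reverse flip ω = trans (length-revApp flip ω ε) (+-identityʳ (length ω))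

open Walks

-- Boolean reflection

∨-true⁻ : ∀ a b → a ∨ b ≡ true → a ≡ true ⊎ b ≡ true
∨-true⁻ true _ _ = inj₁ refl
∨-true⁻ false _ e = inj₂ e

∨-trueˡ : ∀ {a} b → a ≡ true → a ∨ b ≡ true
∨-trueˡ _ refl = refl

∨-trueʳ : ∀ a {b} → b ≡ true → a ∨ b ≡ true
∨-trueʳ true _ = refl
∨-trueʳ false e = e

∧-true : ∀ {a b} → a ≡ true → b ≡ true → a ∧ b ≡ true
∧-true refl refl = refl

∧-true⁻ : ∀ a b → a ∧ b ≡ true → a ≡ true × b ≡ true
∧-true⁻ true true _ = refl , refl

not-true⁻ : ∀ {b} → not b ≡ true → b ≡ false
not-true⁻ {false} _ = refl

not-false : ∀ {b} → b ≡ false → not b ≡ true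
not-false refl = refl

anyV-true⁻ : ∀ {m} (f : Fin m → Bool) → anyV f ≡ true → ∃ λ v → f v ≡ true
anyV-true⁻ {m} f e with satisfied (any⁻ f (allFin m) (Equivalence.from T-≡ e))
... | v , fv = v , Equivalence.to T-≡ fv

anyV-true⁺ : ∀ {m} (f : Fin m → Bool) v → f v ≡ true → anyV f ≡ true
anyV-true⁺ f v e = Equivalence.to T-≡ (any⁺ f (lose (∈-allFin v) (Equivalence.from T-≡ e)))

≟-true⁻ : ∀ {m} {a b : Fin m} → ⌊ a ≟ b ⌋ ≡ true → a ≡ b
≟-true⁻ e = toWitness (Equivalence.from T-≡ e)

≟-refl : ∀ {m} (a : Fin m) → ⌊ a ≟ a ⌋ ≡ true
≟-refl a = trans (isYes≗does (a ≟ a)) (dec-true (a ≟ a) refl)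

≟-false : ∀ {m} {a b : Fin m} → a ≢ b → ⌊ a ≟ b ⌋ ≡ false
≟-false {a = a} {b} a≢b = trans (isYes≗does (a ≟ b)) (dec-false (a ≟ b) a≢b)

least-minimal : ∀ (f : ℕ → Bool) m k → k < least f m → f k ≡ false
least-minimal f (suc m) k k< with f 0 in f0
least-minimal f (suc m) zero k< | false = f0
least-minimal f (suc m) (suc k) (s≤s k<) | false = least-minimal (λ j → f (suc j)) m k k<

least-correct : ∀ (f : ℕ → Bool) m k → k ≤ m → f k ≡ true → f (least f m) ≡ true
least-correct f zero zero z≤n e = e
least-correct f (suc m) k k≤ e with f 0 in f0
... | true = f0
least-correct f (suc m) zero k≤ e | false with () ← trans (sym f0) e
least-correct f (suc m) (suc k) (s≤s k≤) e | false = least-correct (λ j → f (suc j)) m k k≤ e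

-- Distances

Adjacent : ∀ {n} → Adj n → Rel (Fin n) 0ℓ
Adjacent A u v = A u v ≡ true

module Distance {n : ℕ} (A : Adj n) where

  reach⇒walk : ∀ k {u v} → reach A k u v ≡ true → Σ (Star (Adjacent A) u v) λ ω → length ω ≤ k
  reach⇒walk zero e with ≟-true⁻ e
  ... | refl = ε , z≤n
  reach⇒walk (suc k) {u} {v} e with ∨-true⁻ (reach A k u v) _ e
  ... | inj₁ e′ with reach⇒walk k e′
  ...   | ω , ω≤ = ω , m≤n⇒m≤1+n ω≤
  reach⇒walk (suc k) {u} {v} e | inj₂ e′ with anyV-true⁻ _ e′
  ...   | w , e″ with ∧-true⁻ (reach A k u w) (A w v) e″
  ...     | uw , wv with reach⇒walk k uw
  ...       | ω , ω≤ = ω ◅◅ (wv ◅ ε) ,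
                subst (_≤ suc k) (sym (trans (length-◅◅ ω (wv ◅ ε)) (+-comm (length ω) 1))) (s≤s ω≤)

  reach-mono : ∀ {k j u v} → k ≤ j → reach A k u v ≡ true → reach A j u v ≡ true
  reach-mono {j = suc j} {u} {v} k≤j e with m≤n⇒m<n∨m≡n k≤j
  ... | inj₁ (s≤s k≤j′) = ∨-trueˡ _ (reach-mono k≤j′ e)
  ... | inj₂ refl = e
  reach-mono {j = zero} z≤n e = e

  reach-extend : ∀ {k z w v} → reach A k z w ≡ true → (ω : Star (Adjacent A) w v) →
                 reach A (k + length ω) z v ≡ true
  reach-extend {k} e ε rewrite +-identityʳ k = e
  reach-extend {k} {z} {w} e (_◅_ {j = w′} h ω) rewrite +-suc k (length ω) =
    reach-extend {suc k} (∨-trueʳ (reach A k z w′) (anyV-true⁺ (λ t → reach A k z t ∧ A t w′) w (∧-true e h)))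
                 ω

  walk⇒reach : ∀ {u v} (ω : Star (Adjacent A) u v) {k} → length ω ≤ k → reach A k u v ≡ true
  walk⇒reach {u} ω ω≤ = reach-mono ω≤ (reach-extend {0} (≟-refl u) ω)

  dist-≤-length : ∀ {u v} (ω : Star (Adjacent A) u v) → dist A u v ≤ length ω
  dist-≤-length {u} {v} ω = ≮⇒≥ λ ω<dist →
    contradiction (trans (sym (walk⇒reach ω ≤-refl)) (least-minimal (λ k → reach A k u v) n (length ω) ω<dist))
                  λ ()

  dist-self : ∀ u → dist A u u ≡ 0
  dist-self u = n≤0⇒n≡0 (dist-≤-length {u} ε)

  module Connected (connected : ∀ u v → Star (Adjacent A) u v) where

    geodesic : ∀ u v → Σ (Star (Adjacent A) u v) λ ω → length ω ≤ dist A u v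
    geodesic u v with shortcut (connected u v)
    ... | ω , simple , _ = reach⇒walk (dist A u v)
          (least-correct (λ k → reach A k u v) n (length ω) (<⇒≤ (simple-length< ω simple))
                         (walk⇒reach ω ≤-refl))

    dist-via-sole-neighbour : ∀ {x a} → (∀ w → A x w ≡ true → w ≡ a) → A x a ≡ true →
                              ∀ v → v ≢ x → dist A x v ≡ suc (dist A a v)
    dist-via-sole-neighbour {x} {a} sole xa v v≢x = ≤-antisym ≤via ≥via
      where
      ≤via : dist A x v ≤ suc (dist A a v)
      ≤via with geodesic a v
      ... | ω , ω≤ = ≤-trans (dist-≤-length (xa ◅ ω)) (s≤s ω≤)
      ≥via : suc (dist A a v) ≤ dist A x v
      ≥via with geodesic x v
      ... | ε , _ = ⊥-elim (v≢x refl)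
      ... | _◅_ {j = w} xw ω , ω≤ with sole w xw
      ...   | refl = ≤-trans (s≤s (dist-≤-length ω)) ω≤

    module Symmetric (symmetric : ∀ u v → A u v ≡ A v u) where

      adjacent-sym : ∀ {u v} → Adjacent A u v → Adjacent A v u
      adjacent-sym {u} {v} uv = trans (symmetric v u) uv

      dist-≤-dist-swapped : ∀ u v → dist A u v ≤ dist A v u
      dist-≤-dist-swapped u v with geodesic v u
      ... | ω , ω≤ = ≤-trans (dist-≤-length (reverse adjacent-sym ω))
                             (subst (_≤ dist A v u) (sym (length-reverse adjacent-sym ω)) ω≤)

      dist-sym : ∀ u v → dist A u v ≡ dist A v u
      dist-sym u v = ≤-antisym (dist-≤-dist-swapped u v) (dist-≤-dist-swapped v u)

walk⇒star : ∀ {n} {A : Adj n} {u v} → Walk A u v → Star (Adjacent A) u v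
walk⇒star Walk.[] = ε
walk⇒star (Walk.step h ω) = h ◅ walk⇒star ω

module _ {n : ℕ} (G H : Adj n) {x a : Fin n} (symmetric : ∀ u v → G u v ≡ G v u)
         (sole : ∀ w → G x w ≡ true → w ≡ a)
         (agree : ∀ u w → u ≢ x → w ≢ x → G u w ≡ H u w) where

  -- A simple walk with both ends ≠ x never visits x: the vertices before and after x would both be a.
  transfer-walk : ∀ {u v} (ω : Star (Adjacent G) u v) → Simple ω → u ≢ x → v ≢ x →
                  Σ (Star (Adjacent H) u v) λ ω′ → length ω′ ≡ length ω
  transfer-walk ε _ _ _ = ε , refl
  transfer-walk {u} (_◅_ {j = w} uw ω) (fresh , simple) u≢x v≢x with w ≟ x
  ... | no w≢x with transfer-walk ω simple w≢x v≢x
  ...   | ω′ , same = trans (sym (agree u w u≢x w≢x)) uw ◅ ω′ , cong suc same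
  transfer-walk (uw ◅ ε) _ _ v≢x | yes refl = ⊥-elim (v≢x refl)
  transfer-walk {u} (uw ◅ (_◅_ {j = w′} xw′ ω)) (fresh , _) _ _ | yes refl =
    ⊥-elim (fresh (suc zero) (trans (sole w′ xw′) (sym (sole u (trans (symmetric x u) uw)))))

  dist-≤-of-agree : (∀ u v → Star (Adjacent G) u v) → ∀ u v → u ≢ x → v ≢ x → dist H u v ≤ dist G u v
  dist-≤-of-agree connected u v u≢x v≢x with Distance.Connected.geodesic G connected u v
  ... | ω , ω≤ with shortcut ω
  ...   | ω₁ , simple , ω₁≤ with transfer-walk ω₁ simple u≢x v≢x
  ...     | ω₂ , same =
    ≤-trans (Distance.dist-≤-length H ω₂) (≤-trans (≤-reflexive same) (≤-trans ω₁≤ ω≤))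

-- Trees

IsEdge : ∀ {n} → Fin n → Fin n → Fin n → Fin n → Set
IsEdge a b u w = (u ≡ a × w ≡ b) ⊎ (u ≡ b × w ≡ a)

isEdge? : ∀ {n} (a b u w : Fin n) → Dec (IsEdge a b u w)
isEdge? a b u w = ((u ≟ a) ×-dec (w ≟ b)) ⊎-dec ((u ≟ b) ×-dec (w ≟ a))

isEdge-swap : ∀ {n} {a b u w : Fin n} → IsEdge a b u w → IsEdge a b w u
isEdge-swap (inj₁ (ua , wb)) = inj₂ (wb , ua)
isEdge-swap (inj₂ (ub , wa)) = inj₁ (wa , ub)

AvoidingEdge : ∀ {n} → Adj n → Fin n → Fin n → Rel (Fin n) 0ℓ
AvoidingEdge A a b u w = A u w ≡ true × ¬ IsEdge a b u w

module TreeDistance {n : ℕ} {A : Adj n} (T : Tree A) where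
  open Tree T
  open SimpleGraph simple

  connected* : ∀ u v → Star (Adjacent A) u v
  connected* u v = walk⇒star (connected u v)

  open Distance A public
  open Connected connected* public
  open Symmetric symmetric public

  -- z lies on a's side of the edge ab
  Side : Fin n → Fin n → Fin n → Set
  Side a b z = Star (AvoidingEdge A a b) a z

  no-bypass : ∀ {a b} → A a b ≡ true → ¬ Side a b b
  no-bypass {a} {b} ab ω with shortcut ω
  ... | ε , _ with () ← trans (sym ab) (loopless a)
  ... | (_ , not-ab) ◅ ε , _ = not-ab (inj₁ (refl , refl))
  ... | ω′@(_ ◅ _ ◅ _) , simple , _ =
    acyclic (length ω′ , vertex ω′ , s≤s (s≤s z≤n) ,
             (vertex-injective ω′ simple , proj₁ ∘ vertex-step ω′) ,
             subst (λ z → A z a ≡ true) (sym (vertex-last ω′)) (adjacent-sym ab))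

  side-or-shortcut : ∀ {a b u z} (ω : Star (Adjacent A) u z) → Side a b z →
                     Side a b u ⊎ Σ (Star (Adjacent A) a z) (λ ω′ → length ω′ < length ω)
  side-or-shortcut ε side = inj₁ side
  side-or-shortcut {a} {b} {u} (_◅_ {j = w} uw ω) side with side-or-shortcut ω side
  ... | inj₂ (ω′ , shorter) = inj₂ (ω′ , m<n⇒m<1+n shorter)
  ... | inj₁ σ with isEdge? a b u w
  ...   | no not-ab = inj₁ (σ ◅◅ ((adjacent-sym uw , not-ab ∘ isEdge-swap) ◅ ε))
  ...   | yes (inj₁ (refl , refl)) = inj₁ ε
  ...   | yes (inj₂ (refl , refl)) = inj₂ (ω , ≤-refl)

  dist-across-edge : ∀ {a b} → A a b ≡ true → ∀ {z} → Side a b z → dist A b z ≡ suc (dist A a z)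
  dist-across-edge {a} {b} ab {z} side = ≤-antisym ≤across ≥across
    where
    ≤across : dist A b z ≤ suc (dist A a z)
    ≤across with geodesic a z
    ... | ω , ω≤ = ≤-trans (dist-≤-length (adjacent-sym ab ◅ ω)) (s≤s ω≤)
    ≥across : suc (dist A a z) ≤ dist A b z
    ≥across with geodesic b z
    ... | ω , ω≤ with side-or-shortcut ω side
    ...   | inj₁ b-side = ⊥-elim (no-bypass ab b-side)
    ...   | inj₂ (ω′ , shorter) = ≤-trans (s≤s (dist-≤-length ω′)) (≤-trans shorter ω≤)

-- Moving a leaf

module MoveLeaf {n : ℕ} (A : Adj n) (x y′ : Fin n) where

  A′ : Adj n
  A′ = moveLeaf A x y′

  moveLeaf-agree : ∀ u w → u ≢ x → w ≢ x → A u w ≡ A′ u w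
  moveLeaf-agree u w u≢x w≢x with u ≟ x | w ≟ x
  ... | yes u≡x | _ = ⊥-elim (u≢x u≡x)
  ... | no _ | yes w≡x = ⊥-elim (w≢x w≡x)
  ... | no _ | no _ = refl

  moveLeaf-symmetric : (∀ u v → A u v ≡ A v u) → ∀ u w → A′ u w ≡ A′ w u
  moveLeaf-symmetric symmetric u w with u ≟ x | w ≟ x
  ... | yes refl | yes refl = refl
  ... | yes _ | no _ = refl
  ... | no _ | yes _ = refl
  ... | no _ | no _ = symmetric u w

  moveLeaf-sole : ∀ w → A′ x w ≡ true → w ≡ y′
  moveLeaf-sole w e with x ≟ x
  ... | yes _ = ≟-true⁻ e
  ... | no x≢x = ⊥-elim (x≢x refl)

  moveLeaf-new-edge : A′ x y′ ≡ true
  moveLeaf-new-edge with x ≟ x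
  ... | yes _ = ≟-refl y′
  ... | no x≢x = ⊥-elim (x≢x refl)

  module _ (T : Tree A) {a : Fin n} (sole : ∀ w → A x w ≡ true → w ≡ a) (y′≢x : y′ ≢ x) where
    open TreeDistance T using (connected*)
    open SimpleGraph (Tree.simple T)

    private
      walk-avoiding-x : ∀ u v → u ≢ x → v ≢ x → Star (Adjacent A′) u v
      walk-avoiding-x u v u≢x v≢x with shortcut (connected* u v)
      ... | ω , simple , _ = proj₁ (transfer-walk A A′ symmetric sole moveLeaf-agree ω simple u≢x v≢x)

    moveLeaf-connected : ∀ u v → Star (Adjacent A′) u v
    moveLeaf-connected u v with u ≟ x | v ≟ x
    ... | yes refl | yes refl = ε
    ... | yes refl | no v≢x = moveLeaf-new-edge ◅ walk-avoiding-x y′ v y′≢x v≢x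
    ... | no u≢x | yes refl = walk-avoiding-x u y′ u≢x y′≢x ◅◅
                              (trans (moveLeaf-symmetric symmetric y′ x) moveLeaf-new-edge ◅ ε)
    ... | no u≢x | no v≢x = walk-avoiding-x u v u≢x v≢x

    dist-moveLeaf : ∀ u v → u ≢ x → v ≢ x → dist A′ u v ≡ dist A u v
    dist-moveLeaf u v u≢x v≢x = ≤-antisym
      (dist-≤-of-agree A A′ symmetric sole moveLeaf-agree connected* u v u≢x v≢x)
      (dist-≤-of-agree A′ A (moveLeaf-symmetric symmetric) moveLeaf-sole
        (λ u w u≢x w≢x → sym (moveLeaf-agree u w u≢x w≢x)) moveLeaf-connected u v u≢x v≢x)

-- Distances to a path

module AlongPath {n : ℕ} {A : Adj n} (T : Tree A) {r : ℕ} {p : Fin (suc r) → Fin n}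
                 (path : IsPath A r p) where
  open TreeDistance T

  -- index j = zero for j > r; only j ≤ r is ever used.
  index : ℕ → Fin (suc r)
  index j with j <? suc r
  ... | yes j<1+r = fromℕ< j<1+r
  ... | no _ = zero

  toℕ-index : ∀ {j} → j ≤ r → toℕ (index j) ≡ j
  toℕ-index {j} j≤r with j <? suc r
  ... | yes j<1+r = toℕ-fromℕ< j<1+r
  ... | no j≮1+r = ⊥-elim (j≮1+r (s≤s j≤r))

  index-toℕ : ∀ i → index (toℕ i) ≡ i
  index-toℕ i = toℕ-injective (toℕ-index (toℕ≤pred[n] i))

  vertexAt : ℕ → Fin n
  vertexAt j = p (index j)

  vertexAt-toℕ : ∀ i → vertexAt (toℕ i) ≡ p i
  vertexAt-toℕ i = cong p (index-toℕ i)

  vertexAt-injective : ∀ {j k} → j ≤ r → k ≤ r → vertexAt j ≡ vertexAt k → j ≡ k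
  vertexAt-injective j≤r k≤r e =
    trans (sym (toℕ-index j≤r)) (trans (cong toℕ (proj₁ path e)) (toℕ-index k≤r))

  vertexAt-adjacent : ∀ j → j < r → A (vertexAt j) (vertexAt (suc j)) ≡ true
  vertexAt-adjacent j j<r = subst₂ (λ a b → A a b ≡ true)
    (vertexAt-≡ (inject₁ i) (trans (toℕ-inject₁ i) (toℕ-fromℕ< j<r)))
    (vertexAt-≡ (suc i) (cong suc (toℕ-fromℕ< j<r)))
    (proj₂ path i)
    where
    i = fromℕ< j<r
    vertexAt-≡ : ∀ i′ {k} → toℕ i′ ≡ k → p i′ ≡ vertexAt k
    vertexAt-≡ i′ refl = sym (vertexAt-toℕ i′)

  vertexAt-adjacent′ : ∀ j → j < r → A (vertexAt (suc j)) (vertexAt j) ≡ true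
  vertexAt-adjacent′ j j<r = adjacent-sym (vertexAt-adjacent j j<r)

  onPath-true⁻ : ∀ {v} → onPath p v ≡ true → ∃ λ j → p j ≡ v
  onPath-true⁻ e with anyV-true⁻ _ e
  ... | j , pj≟v = j , ≟-true⁻ pj≟v

  onPath-vertex : ∀ j → onPath p (p j) ≡ true
  onPath-vertex j = anyV-true⁺ (λ j′ → ⌊ p j′ ≟ p j ⌋) j (≟-refl (p j))

  onPath-vertexAt : ∀ j → onPath p (vertexAt j) ≡ true
  onPath-vertexAt j = onPath-vertex (index j)

  offPath-≢ : ∀ {w} j → onPath p w ≡ false → w ≢ vertexAt j
  offPath-≢ j off refl with () ← trans (sym (onPath-vertexAt j)) off

  OffPath : Rel (Fin n) 0ℓ
  OffPath = Adjacent (deletePath A p)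

  offPath-sym : ∀ {u w} → OffPath u w → OffPath w u
  offPath-sym {u} {w} e with ∧-true⁻ (A u w) _ e
  ... | uw , e′ with ∧-true⁻ (not (onPath p u)) _ e′
  ...   | u-off , w-off = ∧-true (adjacent-sym uw) (∧-true w-off u-off)

  HangsAt : ℕ → Fin n → Set
  HangsAt i v = v ≡ vertexAt i ⊎
                Σ (Fin n) λ w → A (vertexAt i) w ≡ true × onPath p w ≡ false × Star OffPath w v

  descend : ∀ {R : Rel (Fin n) 0ℓ} {i} m → i ≤ m →
            (∀ j → i ≤ j → j < m → R (vertexAt (suc j)) (vertexAt j)) → Star R (vertexAt m) (vertexAt i)
  descend zero z≤n _ = ε
  descend (suc m) i≤1+m edge with m≤n⇒m<n∨m≡n i≤1+m
  ... | inj₂ refl = ε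
  ... | inj₁ (s≤s i≤m) = edge m i≤m ≤-refl ◅ descend m i≤m (λ j i≤j j<m → edge j i≤j (m<n⇒m<1+n j<m))

  ascend : ∀ {R : Rel (Fin n) 0ℓ} {i} m → i ≤ m →
           (∀ j → i ≤ j → j < m → R (vertexAt j) (vertexAt (suc j))) → Star R (vertexAt i) (vertexAt m)
  ascend zero z≤n _ = ε
  ascend (suc m) i≤1+m edge with m≤n⇒m<n∨m≡n i≤1+m
  ... | inj₂ refl = ε
  ... | inj₁ (s≤s i≤m) =
    ascend m i≤m (λ j i≤j j<m → edge j i≤j (m<n⇒m<1+n j<m)) ◅◅ (edge m i≤m ≤-refl ◅ ε)

  branch-avoids : ∀ {s t} → s ≤ r → t ≤ r → ∀ {i v} → HangsAt i v →
                  Star (AvoidingEdge A (vertexAt s) (vertexAt t)) (vertexAt i) v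
  branch-avoids s≤r t≤r (inj₁ refl) = ε
  branch-avoids {s} {t} s≤r t≤r (inj₂ (w , iw , w-off , ω)) =
    (iw , λ { (inj₁ (_ , w≡t)) → offPath-≢ t w-off w≡t ; (inj₂ (_ , w≡s)) → offPath-≢ s w-off w≡s })
      ◅ Star.map off-avoids ω
    where
    off-avoids : ∀ {u w} → OffPath u w → AvoidingEdge A (vertexAt s) (vertexAt t) u w
    off-avoids {u} {w} e with ∧-true⁻ (A u w) _ e
    ... | uw , e′ with ∧-true⁻ (not (onPath p u)) _ e′
    ...   | u-off , _ = uw , λ { (inj₁ (u≡s , _)) → offPath-≢ s (not-true⁻ u-off) u≡s
                               ; (inj₂ (u≡t , _)) → offPath-≢ t (not-true⁻ u-off) u≡t }

  side-below : ∀ {m} → m < r → ∀ {i v} → i ≤ m → HangsAt i v → Side (vertexAt m) (vertexAt (suc m)) v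
  side-below {m} m<r {i} i≤m hangs = descend m i≤m avoids ◅◅ branch-avoids (<⇒≤ m<r) m<r {i} hangs
    where
    avoids : ∀ j → i ≤ j → j < m → AvoidingEdge A (vertexAt m) (vertexAt (suc m)) (vertexAt (suc j)) (vertexAt j)
    avoids j _ j<m = vertexAt-adjacent′ j j<r , λ
      { (inj₁ (_ , j≡1+m)) → <-asym j<m (≤-trans (n<1+n m) (≤-reflexive (sym (same j≡1+m m<r))))
      ; (inj₂ (_ , j≡m)) → <-irrefl (same j≡m (<⇒≤ m<r)) j<m }
      where
      j<r = <-trans j<m m<r
      same : ∀ {k} → vertexAt j ≡ vertexAt k → k ≤ r → j ≡ k
      same e k≤r = vertexAt-injective (<⇒≤ j<r) k≤r e

  side-above : ∀ {m} → m < r → ∀ {i v} → suc m ≤ i → i ≤ r → HangsAt i v →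
               Side (vertexAt (suc m)) (vertexAt m) v
  side-above {m} m<r {i} m<i i≤r hangs = ascend i m<i avoids ◅◅ branch-avoids m<r (<⇒≤ m<r) {i} hangs
    where
    avoids : ∀ j → suc m ≤ j → j < i →
             AvoidingEdge A (vertexAt (suc m)) (vertexAt m) (vertexAt j) (vertexAt (suc j))
    avoids j m<j j<i = vertexAt-adjacent j j<r , λ
      { (inj₁ (_ , 1+j≡m)) → <-asym m<j (≤-reflexive (vertexAt-injective j<r (<⇒≤ m<r) 1+j≡m))
      ; (inj₂ (j≡m , _)) → <-irrefl (sym (vertexAt-injective (<⇒≤ j<r) (<⇒≤ m<r) j≡m)) m<j }
      where
      j<r = <-≤-trans j<i i≤r

  module _ (v : Fin n) where

    distFrom : ℕ → ℕ
    distFrom j = dist A (vertexAt j) v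

    dist-above : ∀ {i} → HangsAt i v → ∀ k → i + k ≤ r → distFrom (i + k) ≡ k + distFrom i
    dist-above {i} hangs zero _ = cong distFrom (+-identityʳ i)
    dist-above {i} hangs (suc k) i+1+k≤r rewrite +-suc i k =
      trans (dist-across-edge (vertexAt-adjacent (i + k) i+1+k≤r)
                              (side-below i+1+k≤r (m≤m+n i k) hangs))
            (cong suc (dist-above hangs k (<⇒≤ i+1+k≤r)))

    dist-below : ∀ {i} → HangsAt i v → i ≤ r → ∀ k j → j + k ≡ i → distFrom j ≡ k + distFrom i
    dist-below hangs _ zero j j+0≡i = cong distFrom (trans (sym (+-identityʳ j)) j+0≡i)
    dist-below {i} hangs i≤r (suc k) j j+1+k≡i =
      trans (dist-across-edge (vertexAt-adjacent′ j j<r) (side-above j<r j<i i≤r hangs))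
            (cong suc (dist-below hangs i≤r k (suc j) 1+j+k≡i))
      where
      1+j+k≡i : suc j + k ≡ i
      1+j+k≡i = trans (sym (+-suc j k)) j+1+k≡i
      j<i : suc j ≤ i
      j<i = subst (suc j ≤_) 1+j+k≡i (m≤m+n (suc j) k)
      j<r : j < r
      j<r = <-≤-trans j<i i≤r

  private
    no-hanging-above : ∀ {v i} o → HangsAt i v → HangsAt (suc i + o) v → suc i + o ≤ r → ⊥
    no-hanging-above {v} {i} o below above k≤r = m≢1+n+m (distFrom v k) loop
      where
      k = suc i + o
      i+1+o≡k : i + suc o ≡ k
      i+1+o≡k = +-suc i o
      up : distFrom v k ≡ suc o + distFrom v i
      up = trans (cong (distFrom v) (sym i+1+o≡k))
                 (dist-above v below (suc o) (subst (_≤ r) (sym i+1+o≡k) k≤r))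
      down : distFrom v i ≡ suc o + distFrom v k
      down = dist-below v above k≤r (suc o) i i+1+o≡k
      loop : distFrom v k ≡ suc (o + suc o + distFrom v k)
      loop = trans up (trans (cong (λ d → suc o + d) down) (cong suc (sym (+-assoc o (suc o) _))))

  hangsAt-unique : ∀ {v i k} → HangsAt i v → HangsAt k v → i ≤ r → k ≤ r → i ≡ k
  hangsAt-unique {v} {i} {k} at-i at-k i≤r k≤r with <-cmp i k
  ... | tri≈ _ i≡k _ = i≡k
  ... | tri< i<k _ _ with m≤n⇒∃[o]m+o≡n i<k
  ...   | o , refl = ⊥-elim (no-hanging-above o at-i at-k k≤r)
  hangsAt-unique {v} {i} {k} at-i at-k i≤r k≤r | tri> _ _ k<i with m≤n⇒∃[o]m+o≡n k<i
  ...   | o , refl = ⊥-elim (no-hanging-above o at-k at-i i≤r)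

  first-hit : ∀ {u z} (ω : Star (Adjacent A) u z) → onPath p u ≡ false → onPath p z ≡ true →
              Σ (Fin n) λ w → Σ (Fin (suc r)) λ j → A w (p j) ≡ true × onPath p w ≡ false × Star OffPath u w
  first-hit ε u-off z-on with () ← trans (sym u-off) z-on
  first-hit {u} (_◅_ {j = u′} uu′ ω) u-off z-on with onPath p u′ in u′-on?
  ... | true with onPath-true⁻ u′-on?
  ...   | j , refl = u , j , uu′ , u-off , ε
  first-hit {u} (_◅_ {j = u′} uu′ ω) u-off z-on | false with first-hit ω u′-on? z-on
  ...   | w , j , wj , w-off , σ =
    w , j , wj , w-off , ∧-true uu′ (∧-true (not-false u-off) (not-false u′-on?)) ◅ σ

  branch⇒inTi : ∀ {v w} i → onPath p v ≡ false → A w (p i) ≡ true → onPath p w ≡ false →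
                Star OffPath v w → inTi A p i v ≡ true
  branch⇒inTi {v} {w} i v-off wi w-off ω with shortcut ω
  ... | ω₁ , simple , _ =
    ∧-true (not-false v-off)
      (anyV-true⁺ (λ t → A t (p i) ∧ not (onPath p t) ∧ reach (deletePath A p) n v t) w
        (∧-true wi (∧-true (not-false w-off)
          (Distance.walk⇒reach (deletePath A p) ω₁ (<⇒≤ (simple-length< ω₁ simple))))))

  inTi⇒branch : ∀ {v} i → inTi A p i v ≡ true →
                onPath p v ≡ false × Σ (Fin n) λ w → A w (p i) ≡ true × onPath p w ≡ false × Star OffPath v w
  inTi⇒branch {v} i e with ∧-true⁻ (not (onPath p v)) _ e
  ... | v-off , e′ with anyV-true⁻ _ e′
  ...   | w , e″ with ∧-true⁻ (A w (p i)) _ e″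
  ...     | wi , e‴ with ∧-true⁻ (not (onPath p w)) _ e‴
  ...       | w-off , vw = not-true⁻ v-off , w , wi , not-true⁻ w-off ,
                           proj₁ (Distance.reach⇒walk (deletePath A p) n vw)

  inTi⇒hangsAt : ∀ {v} i → inTi A p i v ≡ true → HangsAt (toℕ i) v
  inTi⇒hangsAt i e with inTi⇒branch i e
  ... | _ , w , wi , w-off , ω =
    inj₂ (w , subst (λ z → A z w ≡ true) (sym (vertexAt-toℕ i)) (adjacent-sym wi) , w-off ,
          reverse offPath-sym ω)

-- Finite sums

∑-zero : ∀ {m} (f : Fin m → ℤ) → (∀ i → f i ≡ + 0) → ∑[ i < m ] f i ≡ + 0
∑-zero {m} f f≡0 = trans (sum-cong-≗ f≡0) (sum-replicate-zero m)

∑-single : ∀ {m} (f : Fin m → ℤ) a → (∀ i → i ≢ a → f i ≡ + 0) → ∑[ i < m ] f i ≡ f a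
∑-single {suc m} f a f≡0 = begin
  ∑[ i < suc m ] f i                       ≡⟨ sum-remove {i = a} f ⟩
  f a +ᶻ ∑[ i < m ] f (punchIn a i)        ≡⟨ cong (f a +ᶻ_) (∑-zero _ (λ i → f≡0 _ (punchInᵢ≢i a i))) ⟩
  f a +ᶻ + 0                               ≡⟨ +ᶻ-identityʳ (f a) ⟩
  f a                                      ∎
  where open ≡-Reasoning

∑-neg : ∀ {m} (g : Fin m → ℤ) → ∑[ i < m ] (- g i) ≡ - ∑[ i < m ] g i
∑-neg {m} g = begin
  ∑[ i < m ] (- g i)          ≡⟨ sum-cong-≗ (λ i → sym (-1*i≡-i (g i))) ⟩
  ∑[ i < m ] (-1ℤ * g i)      ≡⟨ sym (*-distribˡ-sum -1ℤ g) ⟩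
  -1ℤ * ∑[ i < m ] g i        ≡⟨ -1*i≡-i _ ⟩
  - ∑[ i < m ] g i            ∎
  where open ≡-Reasoning

∑-sub : ∀ {m} (f g : Fin m → ℤ) → ∑[ i < m ] (f i - g i) ≡ ∑[ i < m ] f i - ∑[ i < m ] g i
∑-sub {m} f g = trans (∑-distrib-+ f (λ i → - g i)) (cong (∑[ i < m ] f i +ᶻ_) (∑-neg g))

∑-scale : ∀ {m} k (f : Fin m → ℤ) → ∑[ i < m ] (k * f i) ≡ k * ∑[ i < m ] f i
∑-scale k f = sym (*-distribˡ-sum k f)

+sum-allFin : ∀ m (g : Fin m → ℕ) → + sumℕ (map g (allFin m)) ≡ ∑[ i < m ] (+ g i)
+sum-allFin m g = trans (cong (λ xs → + sumℕ xs) (map-tabulate id g)) (go m g)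
  where
  go : ∀ m (g : Fin m → ℕ) → + sumℕ (tabulate g) ≡ ∑[ i < m ] (+ g i)
  go zero g = refl
  go (suc m) g = cong (+ g zero +ᶻ_) (go m (g ∘ suc))

foldr-allFin : ∀ m (g : Fin m → ℤ) → foldr _+ᶻ_ (+ 0) (map g (allFin m)) ≡ ∑[ i < m ] g i
foldr-allFin m g = trans (cong (foldr _+ᶻ_ (+ 0)) (map-tabulate id g)) (go m g)
  where
  go : ∀ m (g : Fin m → ℤ) → foldr _+ᶻ_ (+ 0) (tabulate g) ≡ ∑[ i < m ] g i
  go zero g = refl
  go (suc m) g = cong (g zero +ᶻ_) (go m (g ∘ suc))

∑-toℕ-snoc : ∀ m (f : ℕ → ℤ) → ∑[ j < suc m ] f (toℕ j) ≡ ∑[ j < m ] f (toℕ j) +ᶻ f m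
∑-toℕ-snoc m f = trans (sum-init-last {m} (f ∘ toℕ))
  (cong₂ _+ᶻ_ (sum-cong-≗ {m} (cong f ∘ toℕ-inject₁)) (cong f (toℕ-fromℕ m)))

∑-if : ∀ {m} b (g : Fin m → ℤ) → ∑[ v < m ] (if b then g v else + 0) ≡ (if b then ∑[ v < m ] g v else + 0)
∑-if true g = refl
∑-if {m} false g = ∑-zero {m} (λ _ → + 0) (λ _ → refl)

if-+ : ∀ b (a c : ℤ) → (if b then a +ᶻ c else + 0) ≡ (if b then a else + 0) +ᶻ (if b then c else + 0)
if-+ true a c = refl
if-+ false a c = refl

if-− : ∀ b (a c : ℕ) → + (if b then a else 0) - + (if b then c else 0) ≡ (if b then + a - + c else + 0)
if-− true a c = refl
if-− false a c = refl

if-true : ∀ {b} {A : Set} {a c : A} → b ≡ true → (if b then a else c) ≡ a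
if-true refl = refl

if-false : ∀ {b} {A : Set} {a c : A} → b ≡ false → (if b then a else c) ≡ c
if-false refl = refl

if-zero : ∀ b {a : ℤ} → a ≡ + 0 → (if b then a else + 0) ≡ + 0
if-zero true a≡0 = a≡0
if-zero false _ = refl

<ᵇ-false : ∀ {m k} → ¬ m < k → (m <ᵇ k) ≡ false
<ᵇ-false {m} {k} m≮k with m <ᵇ k in m<ᵇk
... | false = refl
... | true = ⊥-elim (m≮k (<ᵇ⇒< m k (subst T (sym m<ᵇk) tt)))

<ᵇ-true : ∀ {m k} → m < k → (m <ᵇ k) ≡ true
<ᵇ-true m<k = Equivalence.to T-≡ (<⇒<ᵇ m<k)

-- wiener A unfolds to pairSum (dist A).
pairSum : ∀ {n} → (Fin n → Fin n → ℕ) → ℕ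
pairSum {n} d =
  sumℕ (map (λ u → sumℕ (map (λ v → if toℕ u <ᵇ toℕ v then d u v else 0) (allFin n))) (allFin n))

module _ {n : ℕ} (d d′ : Fin n → Fin n → ℕ) (x : Fin n)
         (d-sym : ∀ u v → d u v ≡ d v u) (d′-sym : ∀ u v → d′ u v ≡ d′ v u)
         (agree : ∀ u v → u ≢ x → v ≢ x → d′ u v ≡ d u v) (agree-x : d′ x x ≡ d x x) where

  private
    _≺_ : Fin n → Fin n → Bool
    u ≺ v = toℕ u <ᵇ toℕ v

    change : Fin n → Fin n → ℤ
    change u v = + d′ u v - + d u v

    gain : Fin n → ℤ
    gain = change x

    gain-x : gain x ≡ + 0
    gain-x = trans (cong (λ a → + a - + d x x) agree-x) (+ᶻ-inverseʳ (+ d x x))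

    +pairSum : ∀ e → + pairSum e ≡ ∑[ u < n ] ∑[ v < n ] (+ (if u ≺ v then e u v else 0))
    +pairSum e = trans (+sum-allFin n _) (sum-cong-≗ (λ u → +sum-allFin n (λ v → if u ≺ v then e u v else 0)))

    change-split : ∀ u v →
                   change u v ≡ (if ⌊ u ≟ x ⌋ then gain v else + 0) +ᶻ (if ⌊ v ≟ x ⌋ then gain u else + 0)
    change-split u v with u ≟ x | v ≟ x
    ... | yes refl | yes refl = trans gain-x (sym (cong₂ _+ᶻ_ gain-x gain-x))
    ... | yes refl | no _ = sym (+ᶻ-identityʳ _)
    ... | no _ | yes refl = trans (cong₂ (λ a b → + a - + b) (d′-sym u x) (d-sym u x)) (sym (+ᶻ-identityˡ _))
    ... | no u≢x | no v≢x = trans (cong (λ a → + a - + d u v) (agree u v u≢x v≢x)) (+ᶻ-inverseʳ (+ d u v))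

    elsewhere : ∀ {u w} → u ≢ x → (if ⌊ u ≟ x ⌋ then gain w else + 0) ≡ + 0
    elsewhere {u} u≢x with u ≟ x
    ... | yes u≡x = ⊥-elim (u≢x u≡x)
    ... | no _ = refl

    below : (Fin n → Fin n → ℕ) → Fin n → Fin n → ℤ
    below e u v = + (if u ≺ v then e u v else 0)

    row-x column-x : Fin n → Fin n → ℤ
    row-x u v = if u ≺ v then (if ⌊ u ≟ x ⌋ then gain v else + 0) else + 0
    column-x u v = if u ≺ v then (if ⌊ v ≟ x ⌋ then gain u else + 0) else + 0

    after-x before-x : Fin n → ℤ
    after-x v = if x ≺ v then gain v else + 0
    before-x v = if v ≺ x then gain v else + 0

    change-below : ∀ u v → below d′ u v - below d u v ≡ row-x u v +ᶻ column-x u v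
    change-below u v = trans (if-− (u ≺ v) (d′ u v) (d u v))
      (trans (cong (λ c → if u ≺ v then c else + 0) (change-split u v)) (if-+ (u ≺ v) _ _))

    ∑-row-x : ∑[ u < n ] ∑[ v < n ] row-x u v ≡ ∑[ v < n ] after-x v
    ∑-row-x = trans (∑-single (λ u → ∑[ v < n ] row-x u v) x
                      (λ u u≢x → ∑-zero (row-x u) (λ v → if-zero (u ≺ v) (elsewhere u≢x))))
                    (sum-cong-≗ (λ v → cong (λ g → if x ≺ v then g else + 0) (if-true (≟-refl x))))

    ∑-column-x : ∑[ u < n ] ∑[ v < n ] column-x u v ≡ ∑[ u < n ] before-x u
    ∑-column-x = sum-cong-≗ λ u →
      trans (∑-single (column-x u) x (λ v v≢x → if-zero (u ≺ v) (elsewhere v≢x)))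
            (cong (λ g → if u ≺ x then g else + 0) (if-true (≟-refl x)))

    either-side : ∀ v → after-x v +ᶻ before-x v ≡ gain v
    either-side v with v ≟ x
    ... | yes refl = trans (cong₂ _+ᶻ_ (if-zero (x ≺ x) gain-x) (if-zero (x ≺ x) gain-x)) (sym gain-x)
    ... | no v≢x with <-cmp (toℕ x) (toℕ v)
    ...   | tri< x<v _ v≮x rewrite <ᵇ-true x<v | <ᵇ-false v≮x = +ᶻ-identityʳ (gain v)
    ...   | tri≈ _ x≡v _ = ⊥-elim (v≢x (sym (toℕ-injective x≡v)))
    ...   | tri> x≮v _ v<x rewrite <ᵇ-true v<x | <ᵇ-false x≮v = +ᶻ-identityˡ (gain v)

  pairSum-change : + pairSum d′ - + pairSum d ≡ ∑[ v < n ] (+ d′ x v - + d x v)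
  pairSum-change = begin
    + pairSum d′ - + pairSum d
      ≡⟨ cong₂ _-_ (+pairSum d′) (+pairSum d) ⟩
    ∑[ u < n ] ∑[ v < n ] below d′ u v - ∑[ u < n ] ∑[ v < n ] below d u v
      ≡⟨ sym (∑-sub (λ u → ∑[ v < n ] below d′ u v) (λ u → ∑[ v < n ] below d u v)) ⟩
    ∑[ u < n ] (∑[ v < n ] below d′ u v - ∑[ v < n ] below d u v)
      ≡⟨ sum-cong-≗ (λ u → sym (∑-sub (below d′ u) (below d u))) ⟩
    ∑[ u < n ] ∑[ v < n ] (below d′ u v - below d u v)
      ≡⟨ sum-cong-≗ (λ u → trans (sum-cong-≗ (change-below u)) (∑-distrib-+ (row-x u) (column-x u))) ⟩
    ∑[ u < n ] (∑[ v < n ] row-x u v +ᶻ ∑[ v < n ] column-x u v)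
      ≡⟨ ∑-distrib-+ (λ u → ∑[ v < n ] row-x u v) (λ u → ∑[ v < n ] column-x u v) ⟩
    ∑[ u < n ] ∑[ v < n ] row-x u v +ᶻ ∑[ u < n ] ∑[ v < n ] column-x u v
      ≡⟨ cong₂ _+ᶻ_ ∑-row-x ∑-column-x ⟩
    ∑[ v < n ] after-x v +ᶻ ∑[ v < n ] before-x v
      ≡⟨ sym (∑-distrib-+ after-x before-x) ⟩
    ∑[ v < n ] (after-x v +ᶻ before-x v)
      ≡⟨ sum-cong-≗ either-side ⟩
    ∑[ v < n ] gain v
      ∎
    where open ≡-Reasoning

private
  sum-tabulate-≥ : ∀ {m} (g : Fin m → ℕ) a → g a ≤ sumℕ (tabulate g)
  sum-tabulate-≥ g zero = m≤m+n (g zero) _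
  sum-tabulate-≥ g (suc a) = ≤-trans (sum-tabulate-≥ (g ∘ suc) a) (m≤n+m _ (g zero))

  sum-tabulate-≥2 : ∀ {m} (g : Fin m → ℕ) {a b} → a ≢ b → 1 ≤ g a → 1 ≤ g b → 2 ≤ sumℕ (tabulate g)
  sum-tabulate-≥2 g {zero} {zero} a≢b _ _ = ⊥-elim (a≢b refl)
  sum-tabulate-≥2 g {zero} {suc b} _ ga gb = +-mono-≤ ga (≤-trans gb (sum-tabulate-≥ (g ∘ suc) b))
  sum-tabulate-≥2 g {suc a} {zero} _ ga gb =
    subst (2 ≤_) (+-comm _ (g zero)) (+-mono-≤ (≤-trans ga (sum-tabulate-≥ (g ∘ suc) a)) gb)
  sum-tabulate-≥2 g {suc a} {suc b} a≢b ga gb =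
    ≤-trans (sum-tabulate-≥2 (g ∘ suc) (a≢b ∘ cong suc) ga gb) (m≤n+m _ (g zero))

count≡1⇒unique : ∀ {m} (f : Fin m → Bool) → count f ≡ 1 → ∀ {a b} → f a ≡ true → f b ≡ true → a ≡ b
count≡1⇒unique {m} f count≡1 {a} {b} fa fb with a ≟ b
... | yes a≡b = a≡b
... | no a≢b = ⊥-elim (<-irrefl refl (subst (2 ≤_) sum≡1 (sum-tabulate-≥2 indicator a≢b (one fa) (one fb))))
  where
  indicator : Fin m → ℕ
  indicator v = if f v then 1 else 0
  one : ∀ {v} → f v ≡ true → 1 ≤ indicator v
  one fv rewrite fv = ≤-refl
  sum≡1 : sumℕ (tabulate indicator) ≡ 1
  sum≡1 = trans (cong sumℕ (sym (map-tabulate id indicator))) count≡1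

∑-indicator : ∀ {m} (f : Fin m → Bool) s → ∑[ v < m ] (if f v then s else + 0) ≡ s * + count f
∑-indicator {m} f s = begin
  ∑[ v < m ] (if f v then s else + 0)         ≡⟨ sum-cong-≗ (λ v → scaled (f v)) ⟩
  ∑[ v < m ] (s * + (if f v then 1 else 0))   ≡⟨ ∑-scale s (λ v → + (if f v then 1 else 0)) ⟩
  s * ∑[ v < m ] (+ (if f v then 1 else 0))   ≡⟨ cong (s *_) (sym (+sum-allFin m (λ v → if f v then 1 else 0))) ⟩
  s * + count f                               ∎
  where
  open ≡-Reasoning
  scaled : ∀ b → (if b then s else + 0) ≡ s * + (if b then 1 else 0)
  scaled true = sym (*ᶻ-identityʳ s)
  scaled false = sym (*ᶻ-zeroʳ s)

suc-−-suc : ∀ a b → (+ 1 +ᶻ a) - (+ 1 +ᶻ b) ≡ a - b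
suc-−-suc = solve-∀

+-−-+-cancelʳ : ∀ a b c → (a +ᶻ c) - (b +ᶻ c) ≡ a - b
+-−-+-cancelʳ = solve-∀

-- The change of the Wiener index

module LeafMoveAlongPath {n : ℕ} {A : Adj n} (T : Tree A) {x y y′ : Fin n}
  (x-leaf : IsLeaf A x) (y-leaf : IsLeaf A y) (yy′ : A y y′ ≡ true) (y′≢x : y′ ≢ x)
  {r₀ : ℕ} {p : Fin (3 + r₀) → Fin n} (path : IsPath A (2 + r₀) p)
  (p0≡x : p zero ≡ x) (pr≡y : p (fromℕ (2 + r₀)) ≡ y) where

  r : ℕ
  r = 2 + r₀

  open TreeDistance T
  open AlongPath T path
  open MoveLeaf A x y′

  vertexAt-0 : vertexAt 0 ≡ x
  vertexAt-0 = trans (vertexAt-toℕ zero) p0≡x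

  vertexAt-r : vertexAt r ≡ y
  vertexAt-r = trans (cong vertexAt (sym (toℕ-fromℕ r))) (trans (vertexAt-toℕ (fromℕ r)) pr≡y)

  x-adjacent : A x (vertexAt 1) ≡ true
  x-adjacent = subst (λ z → A z (vertexAt 1) ≡ true) vertexAt-0 (vertexAt-adjacent 0 (s≤s z≤n))

  x-sole : ∀ w → A x w ≡ true → w ≡ vertexAt 1
  x-sole w xw = count≡1⇒unique (A x) x-leaf xw x-adjacent

  y-sole : ∀ w → A y w ≡ true → w ≡ vertexAt (suc r₀)
  y-sole w yw = count≡1⇒unique (A y) y-leaf yw y-last
    where
    y-last : A y (vertexAt (suc r₀)) ≡ true
    y-last = subst (λ z → A z (vertexAt (suc r₀)) ≡ true) vertexAt-r (vertexAt-adjacent′ (suc r₀) ≤-refl)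

  vertexAt-≢x : ∀ {j} → suc j ≤ r → vertexAt (suc j) ≢ x
  vertexAt-≢x 1+j≤r e with vertexAt-injective 1+j≤r z≤n (trans e (sym vertexAt-0))
  ... | ()

  gain : Fin n → ℤ
  gain v = + dist A′ x v - + dist A x v

  gain-x : gain x ≡ + 0
  gain-x rewrite Distance.dist-self A′ x | dist-self x = refl

  gain-≢x : ∀ {v} → v ≢ x → gain v ≡ + distFrom v (suc r₀) - + distFrom v 1
  gain-≢x {v} v≢x = begin
    + dist A′ x v - + dist A x v
      ≡⟨ cong₂ (λ a b → + a - + b)
           (Distance.Connected.dist-via-sole-neighbour A′ (moveLeaf-connected T x-sole y′≢x)
              moveLeaf-sole moveLeaf-new-edge v v≢x)
           (dist-via-sole-neighbour x-sole x-adjacent v v≢x) ⟩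
    + suc (dist A′ y′ v) - + suc (distFrom v 1)
      ≡⟨ suc-−-suc (+ dist A′ y′ v) (+ distFrom v 1) ⟩
    + dist A′ y′ v - + distFrom v 1
      ≡⟨ cong (λ a → + a - + distFrom v 1)
           (trans (dist-moveLeaf T x-sole y′≢x y′ v y′≢x v≢x) (cong (λ z → dist A z v) (y-sole y′ yy′))) ⟩
    + distFrom v (suc r₀) - + distFrom v 1
      ∎
    where open ≡-Reasoning

  slope : ℕ → ℤ
  slope j = + r - + (2 ℕ.* j)

  slope-suc : ∀ {t b} → t + b ≡ r₀ → slope (suc t) ≡ + b - + t
  slope-suc {t} {b} t+b≡r₀ =
    trans (cong (λ m → + (2 + m) - + (2 ℕ.* suc t)) (sym t+b≡r₀)) (shift (+ t) (+ b))
    where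
    -- stated in the shape + (2 ℕ.* suc t) unfolds to, as are the identities below
    shift : ∀ a c → (+ 2 +ᶻ (a +ᶻ c)) - ((+ 1 +ᶻ a) +ᶻ ((+ 1 +ᶻ a) +ᶻ + 0)) ≡ c - a
    shift = solve-∀

  gain-inner : ∀ {v t} → HangsAt (suc t) v → t ≤ r₀ → v ≢ x → gain v ≡ slope (suc t)
  gain-inner {v} {t} hangs t≤r₀ v≢x with m≤n⇒∃[o]m+o≡n t≤r₀
  ... | b , t+b≡r₀ = begin
    gain v                                            ≡⟨ gain-≢x v≢x ⟩
    + distFrom v (suc r₀) - + distFrom v 1            ≡⟨ cong₂ (λ a c → + a - + c) far near ⟩
    + (b + distFrom v (suc t)) - + (t + distFrom v (suc t))
                                                      ≡⟨ +-−-+-cancelʳ (+ b) (+ t) (+ distFrom v (suc t)) ⟩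
    + b - + t                                         ≡⟨ sym (slope-suc {t} {b} t+b≡r₀) ⟩
    slope (suc t)                                     ∎
    where
    open ≡-Reasoning
    far : distFrom v (suc r₀) ≡ b + distFrom v (suc t)
    far = trans (cong (distFrom v ∘ suc) (sym t+b≡r₀))
                (dist-above v hangs b (s≤s (subst (_≤ suc r₀) (sym t+b≡r₀) (n≤1+n r₀))))
    near : distFrom v 1 ≡ t + distFrom v (suc t)
    near = dist-below v hangs (s≤s (m≤n⇒m≤1+n t≤r₀)) t 1 refl

  gain-last : ∀ {v} → HangsAt r v → v ≢ x → gain v ≡ + 2 - + r
  gain-last {v} hangs v≢x = begin
    gain v                                            ≡⟨ gain-≢x v≢x ⟩
    + distFrom v (suc r₀) - + distFrom v 1            ≡⟨ cong₂ (λ a c → + a - + c) far near ⟩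
    + (1 + distFrom v r) - + (suc r₀ + distFrom v r)  ≡⟨ +-−-+-cancelʳ (+ 1) (+ suc r₀) (+ distFrom v r) ⟩
    + 1 - + suc r₀                                    ≡⟨ sym (suc-−-suc (+ 1) (+ suc r₀)) ⟩
    + 2 - + r                                         ∎
    where
    open ≡-Reasoning
    far : distFrom v (suc r₀) ≡ 1 + distFrom v r
    far = dist-below v hangs ≤-refl 1 (suc r₀) (+-comm (suc r₀) 1)
    near : distFrom v 1 ≡ suc r₀ + distFrom v r
    near = dist-below v hangs ≤-refl (suc r₀) 1 refl

  ∑-gain-prefix : ∀ k → k ≤ suc r₀ → ∑[ j < suc k ] gain (vertexAt (toℕ j)) ≡ + k * (+ r - (+ k +ᶻ + 1))
  ∑-gain-prefix zero _ = trans (+ᶻ-identityʳ _) (trans (cong gain vertexAt-0) gain-x)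
  ∑-gain-prefix (suc k) (s≤s k≤r₀) = begin
    ∑[ j < suc (suc k) ] gain (vertexAt (toℕ j))
      ≡⟨ ∑-toℕ-snoc (suc k) (gain ∘ vertexAt) ⟩
    ∑[ j < suc k ] gain (vertexAt (toℕ j)) +ᶻ gain (vertexAt (suc k))
      ≡⟨ cong₂ _+ᶻ_ (∑-gain-prefix k (m≤n⇒m≤1+n k≤r₀))
                    (gain-inner (inj₁ refl) k≤r₀ (vertexAt-≢x (s≤s (m≤n⇒m≤1+n k≤r₀)))) ⟩
    + k * (+ r - (+ k +ᶻ + 1)) +ᶻ slope (suc k)
      ≡⟨ next (+ r) (+ k) ⟩
    + suc k * (+ r - (+ suc k +ᶻ + 1))
      ∎
    where
    open ≡-Reasoning
    next : ∀ R a → a * (R - (a +ᶻ + 1)) +ᶻ (R - ((+ 1 +ᶻ a) +ᶻ ((+ 1 +ᶻ a) +ᶻ + 0)))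
                   ≡ (+ 1 +ᶻ a) * (R - ((+ 1 +ᶻ a) +ᶻ + 1))
    next = solve-∀

  ∑-gain-path : ∑[ j < suc r ] gain (p j) ≡ - (+ r - + 2)
  ∑-gain-path = begin
    ∑[ j < suc r ] gain (p j)
      ≡⟨ sum-cong-≗ (λ j → cong gain (sym (vertexAt-toℕ j))) ⟩
    ∑[ j < suc r ] gain (vertexAt (toℕ j))
      ≡⟨ ∑-toℕ-snoc r (gain ∘ vertexAt) ⟩
    ∑[ j < r ] gain (vertexAt (toℕ j)) +ᶻ gain (vertexAt r)
      ≡⟨ cong₂ _+ᶻ_ (∑-gain-prefix (suc r₀) ≤-refl) (gain-last (inj₁ refl) (vertexAt-≢x ≤-refl)) ⟩
    + suc r₀ * (+ r - (+ suc r₀ +ᶻ + 1)) +ᶻ (+ 2 - + r)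
      ≡⟨ total (+ r₀) ⟩
    - (+ r - + 2)
      ∎
    where
    open ≡-Reasoning
    total : ∀ a → (+ 1 +ᶻ a) * ((+ 2 +ᶻ a) - ((+ 1 +ᶻ a) +ᶻ + 1)) +ᶻ (+ 2 - (+ 2 +ᶻ a)) ≡ - ((+ 2 +ᶻ a) - + 2)
    total = solve-∀

  x-onPath : onPath p x ≡ true
  x-onPath = subst (λ z → onPath p z ≡ true) p0≡x (onPath-vertex zero)

  inner : ℕ → Bool
  inner j = (1 ≤ᵇ j) ∧ (j <ᵇ r)

  inTi-inner : ∀ {v} i → inTi A p i v ≡ true → ∃ λ t → toℕ i ≡ suc t × t ≤ r₀
  inTi-inner i e with inTi⇒branch i e
  inTi-inner zero e | _ , w , wi , w-off , _ =
    ⊥-elim (offPath-≢ 1 w-off (x-sole w (adjacent-sym (subst (λ z → A w z ≡ true) p0≡x wi))))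
  inTi-inner (suc i) e | _ , w , wi , w-off , _ with m≤n⇒m<n∨m≡n (toℕ≤pred[n] i)
  ... | inj₁ (s≤s i≤r₀) = toℕ i , refl , i≤r₀
  ... | inj₂ i≡1+r₀ =
    ⊥-elim (offPath-≢ (suc r₀) w-off (y-sole w (adjacent-sym (subst (λ z → A w z ≡ true) i≡y wi))))
    where
    i≡y : p (suc i) ≡ y
    i≡y = trans (sym (vertexAt-toℕ (suc i))) (trans (cong (vertexAt ∘ suc) i≡1+r₀) vertexAt-r)

  offPath-inTi : ∀ {v} → onPath p v ≡ false → ∃ λ i → inTi A p i v ≡ true
  offPath-inTi {v} v-off with first-hit (connected* v x) v-off x-onPath
  ... | w , i , wi , w-off , σ = i , branch⇒inTi i v-off wi w-off σ

  branchTerm pathTerm : Fin n → Fin (suc r) → ℤ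
  branchTerm v i = if inner (toℕ i) then (if inTi A p i v then slope (toℕ i) else + 0) else + 0
  pathTerm v j = if ⌊ p j ≟ v ⌋ then gain (p j) else + 0

  branchPart pathPart : Fin n → ℤ
  branchPart v = ∑[ i < suc r ] branchTerm v i
  pathPart v = ∑[ j < suc r ] pathTerm v j

  branchPart-vertex : ∀ j → branchPart (p j) ≡ + 0
  branchPart-vertex j =
    ∑-zero (branchTerm (p j)) λ i → if-zero (inner (toℕ i)) (if-false (not-onPath (onPath-vertex j)))
    where
    not-onPath : ∀ {v i} → onPath p v ≡ true → inTi A p i v ≡ false
    not-onPath on rewrite on = refl

  pathPart-vertex : ∀ j → pathPart (p j) ≡ gain (p j)
  pathPart-vertex j = trans (∑-single (pathTerm (p j)) j λ k k≢j → if-false (≟-false (k≢j ∘ proj₁ path)))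
                            (if-true (≟-refl (p j)))

  branchPart-inTi : ∀ {v i t} → inTi A p i v ≡ true → toℕ i ≡ suc t → t ≤ r₀ → branchPart v ≡ slope (suc t)
  branchPart-inTi {v} {i} {t} v∈Ti i≡1+t t≤r₀ = trans (∑-single (branchTerm v) i elsewhere) at-i
    where
    elsewhere : ∀ k → k ≢ i → branchTerm v k ≡ + 0
    elsewhere k k≢i with inTi A p k v in v∈Tk
    ... | true = ⊥-elim (k≢i (toℕ-injective
            (hangsAt-unique (inTi⇒hangsAt k v∈Tk) (inTi⇒hangsAt i v∈Ti) (toℕ≤pred[n] k) (toℕ≤pred[n] i))))
    ... | false = if-zero (inner (toℕ k)) refl
    at-i : branchTerm v i ≡ slope (suc t)
    at-i rewrite v∈Ti | i≡1+t | <ᵇ-true (s≤s t≤r₀) = refl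

  pathPart-offPath : ∀ {v} → onPath p v ≡ false → pathPart v ≡ + 0
  pathPart-offPath {v} v-off = ∑-zero (pathTerm v) λ j → if-false (≟-false λ pj≡v →
    offPath-≢ (toℕ j) v-off (trans (sym pj≡v) (sym (vertexAt-toℕ j))))

  gain-split-vertex : ∀ j → gain (p j) ≡ branchPart (p j) +ᶻ pathPart (p j)
  gain-split-vertex j =
    sym (trans (cong₂ _+ᶻ_ (branchPart-vertex j) (pathPart-vertex j)) (+ᶻ-identityˡ (gain (p j))))

  gain-split-offPath : ∀ {v} → onPath p v ≡ false → gain v ≡ branchPart v +ᶻ pathPart v
  gain-split-offPath {v} v-off with offPath-inTi v-off
  ... | i , v∈Ti with inTi-inner i v∈Ti
  ...   | t , i≡1+t , t≤r₀ = begin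
    gain v
      ≡⟨ gain-inner hangs t≤r₀ v≢x ⟩
    slope (suc t)
      ≡⟨ sym (+ᶻ-identityʳ _) ⟩
    slope (suc t) +ᶻ + 0
      ≡⟨ sym (cong₂ _+ᶻ_ (branchPart-inTi v∈Ti i≡1+t t≤r₀) (pathPart-offPath v-off)) ⟩
    branchPart v +ᶻ pathPart v
      ∎
    where
    open ≡-Reasoning
    hangs : HangsAt (suc t) v
    hangs = subst (λ k → HangsAt k v) i≡1+t (inTi⇒hangsAt i v∈Ti)
    v≢x : v ≢ x
    v≢x v≡x = offPath-≢ 0 v-off (trans v≡x (sym vertexAt-0))

  gain-split : ∀ v → gain v ≡ branchPart v +ᶻ pathPart v
  gain-split v = by-cases (onPath p v) refl
    where
    by-cases : ∀ b → onPath p v ≡ b → gain v ≡ branchPart v +ᶻ pathPart v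
    by-cases true on with onPath-true⁻ on
    ... | j , pj≡v = subst (λ z → gain z ≡ branchPart z +ᶻ pathPart z) pj≡v (gain-split-vertex j)
    by-cases false off = gain-split-offPath off

  ∑-branchPart : ∑[ v < n ] branchPart v ≡ sumInner r (λ i → slope (toℕ i) * + sizeTi A p i)
  ∑-branchPart = begin
    ∑[ v < n ] ∑[ i < suc r ] branchTerm v i
      ≡⟨ ∑-comm branchTerm ⟩
    ∑[ i < suc r ] ∑[ v < n ] branchTerm v i
      ≡⟨ sum-cong-≗ {suc r} (λ i → trans (∑-if (inner (toℕ i)) (λ v → if inTi A p i v then slope (toℕ i) else + 0))
                     (cong (λ s → if inner (toℕ i) then s else + 0) (∑-indicator (inTi A p i) (slope (toℕ i))))) ⟩
    ∑[ i < suc r ] (if inner (toℕ i) then slope (toℕ i) * + sizeTi A p i else + 0)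
      ≡⟨ sym (foldr-allFin (suc r) (λ i → if inner (toℕ i) then slope (toℕ i) * + sizeTi A p i else + 0)) ⟩
    sumInner r (λ i → slope (toℕ i) * + sizeTi A p i)
      ∎
    where open ≡-Reasoning

  ∑-pathPart : ∑[ v < n ] pathPart v ≡ - (+ r - + 2)
  ∑-pathPart = begin
    ∑[ v < n ] ∑[ j < suc r ] pathTerm v j
      ≡⟨ ∑-comm pathTerm ⟩
    ∑[ j < suc r ] ∑[ v < n ] pathTerm v j
      ≡⟨ sum-cong-≗ (λ j → trans (∑-single (λ v → pathTerm v j) (p j) (λ v v≢pj → if-false (≟-false (v≢pj ∘ sym))))
                                 (if-true (≟-refl (p j)))) ⟩
    ∑[ j < suc r ] gain (p j)
      ≡⟨ ∑-gain-path ⟩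
    - (+ r - + 2)
      ∎
    where open ≡-Reasoning

  wiener-change : + wiener A′ - + wiener A ≡ sumInner r (λ i → slope (toℕ i) * + sizeTi A p i) - (+ r - + 2)
  wiener-change = begin
    + wiener A′ - + wiener A
      ≡⟨ pairSum-change (dist A) (dist A′) x dist-sym dist-sym′ dist-unchanged
                        (trans (Distance.dist-self A′ x) (sym (dist-self x))) ⟩
    ∑[ v < n ] gain v
      ≡⟨ sum-cong-≗ gain-split ⟩
    ∑[ v < n ] (branchPart v +ᶻ pathPart v)
      ≡⟨ ∑-distrib-+ branchPart pathPart ⟩
    ∑[ v < n ] branchPart v +ᶻ ∑[ v < n ] pathPart v
      ≡⟨ cong₂ _+ᶻ_ ∑-branchPart ∑-pathPart ⟩
    sumInner r (λ i → slope (toℕ i) * + sizeTi A p i) - (+ r - + 2)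
      ∎
    where
    open ≡-Reasoning
    dist-sym′ : ∀ u v → dist A′ u v ≡ dist A′ v u
    dist-sym′ = Distance.Connected.Symmetric.dist-sym A′ (moveLeaf-connected T x-sole y′≢x)
                  (moveLeaf-symmetric (SimpleGraph.symmetric (Tree.simple T)))
    dist-unchanged : ∀ u v → u ≢ x → v ≢ x → dist A′ u v ≡ dist A u v
    dist-unchanged = dist-moveLeaf T x-sole y′≢x

mainTheorem11 : (n : ℕ) (A : Adj n) → Tree A →
    (x y y' : Fin n) → IsLeaf A x → IsLeaf A y → x ≢ y →
    A y y' ≡ true → y' ≢ x →
    (r : ℕ) (p : Fin (suc r) → Fin n) → IsPath A r p → p zero ≡ x → p (fromℕ r) ≡ y →
    (+ wiener (moveLeaf A x y')) - (+ wiener A)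
      ≡ sumInner r (λ i → ((+ r) - (+ (2 ℕ.* toℕ i))) * (+ sizeTi A p i)) - ((+ r) - (+ 2))
mainTheorem11 n A T x y y' x-leaf y-leaf x≢y yy' y'≢x zero p path p0≡x pr≡y =
  ⊥-elim (x≢y (trans (sym p0≡x) pr≡y))
mainTheorem11 n A T x y y' x-leaf y-leaf x≢y yy' y'≢x (suc zero) p path p0≡x pr≡y =
  ⊥-elim (y'≢x (count≡1⇒unique (A y) y-leaf yy' yx))
  where
  yx : A y x ≡ true
  yx = trans (SimpleGraph.symmetric (Tree.simple T) y x)
             (subst₂ (λ a b → A a b ≡ true) p0≡x pr≡y (proj₂ path zero))
mainTheorem11 n A T x y y' x-leaf y-leaf x≢y yy' y'≢x (suc (suc r₀)) p path p0≡x pr≡y =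
  LeafMoveAlongPath.wiener-change T x-leaf y-leaf yy' y'≢x path p0≡x pr≡y
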